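{- Let $f:\mathcal C\to\mathcal D$ be a morphism of neural codes, and let $c_1,c_2\in\mathcal C$ be such that $c_1\cap c_2\in\mathcal C$. Then $f(c_1\cap c_2)=f(c_1)\cap f(c_2)$.
   Context: A neural code is a set $\mathcal C\subseteq 2^{[n]}$ containing $\varnothing$. For $\sigma\subseteq[n]$, the trunk $\mathrm{Tk}_{\mathcal C}(\sigma)=\{\tau\in\mathcal C:\sigma\subseteq\tau\}$; a trunk is proper if nonempty and not equal to $\mathcal C$. A morphism $f:\mathcal C\to\mathcal D$ of neural codes is a function such that the preimage of every proper trunk in $\mathcal D$ is a proper trunk in $\mathcal C$. -}

module Defs where

open import Data.Nat using (ℕ)
open import Data.Bool using (Bool; T)
open import Data.Fin.Subset using (Subset; ⊥; _⊆_; _∩_)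
open import Data.Product using (Σ; ∃; _×_; proj₁; _,_)
open import Relation.Nullary using (¬_)
open import Function.Bundles using (_⇔_)

record Code (n : ℕ) : Set where
  field
    mem  : Subset n → Bool
    ∅∈   : T (mem ⊥)
open Code public

Word : ∀ {n} → Code n → Set
Word C = Σ (Subset _) λ c → T (mem C c)

word : ∀ {n} {C : Code n} → Word C → Subset n
word = proj₁

InTrunk : ∀ {n} (C : Code n) → Subset n → Word C → Set
InTrunk C σ c = σ ⊆ word {C = C} c

ProperTrunk : ∀ {n} (C : Code n) → Subset n → Set
ProperTrunk C σ = (Σ (Word C) λ c → InTrunk C σ c)
                × ¬ (∀ (c : Word C) → InTrunk C σ c)

IsMorphism : ∀ {m n} (C : Code m) (D : Code n) → (Word C → Word D) → Set
IsMorphism {m} {n} C D f =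
  ∀ (σ : Subset n) → ProperTrunk D σ →
    Σ (Subset m) λ τ → ProperTrunk C τ
      × (∀ (c : Word C) → (InTrunk D σ (f c) ⇔ InTrunk C τ c))

{-# OPTIONS --safe #-}
module Submission where

open import Defs
open import Data.Bool using (T)
open import Data.Fin.Subset using (Subset; _∩_; _⊆_)
open import Data.Fin.Subset.Properties
  using (_⊆?_; ⊆-refl; ⊆-trans; ⊆-antisym; p∩q⊆p; p∩q⊆q; x∈p∩q⁺)
open import Data.Product using (proj₁; _,_)
open import Function.Bundles using (Equivalence)
open import Relation.Nullary.Decidable using (decidable-stable)
open import Relation.Binary.PropositionalEquality using (_≡_)

-- Let σ ⊆ f(c₁) ∩ f(c₂). If Tk_D(σ) is all of D, then σ ⊆ f(c₁ ∩ c₂) trivially;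
-- otherwise it is a proper trunk, whose preimage Tk_C(τ) contains c₁ and c₂,
-- hence τ ⊆ c₁ ∩ c₂ and c₁ ∩ c₂ lies in the preimage too. So morphisms are
-- monotone and send f(c₁) ∩ f(c₂) into f(c₁ ∩ c₂). Decidability of ⊆ makes the
-- case split constructive.

⊆-∩ : ∀ {n} {p q r : Subset n} → p ⊆ q → p ⊆ r → p ⊆ q ∩ r
⊆-∩ p⊆q p⊆r x∈p = x∈p∩q⁺ (p⊆q x∈p , p⊆r x∈p)

module Morphism {m n} (C : Code m) (D : Code n) (f : Word C → Word D)
                (f-mor : IsMorphism C D f) where

  ⊆-image-∩-closed : ∀ {σ : Subset n} (a b c : Word C) →
    σ ⊆ proj₁ (f a) → σ ⊆ proj₁ (f b) → proj₁ a ∩ proj₁ b ⊆ proj₁ c →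
    σ ⊆ proj₁ (f c)
  ⊆-image-∩-closed {σ} a b c σ⊆fa σ⊆fb a∩b⊆c =
    decidable-stable (σ ⊆? proj₁ (f c)) λ σ⊈fc →
      let tk-proper : ProperTrunk D σ
          tk-proper = (f a , σ⊆fa) , λ σ⊆all → σ⊈fc (σ⊆all (f c))
          (τ , _ , preimage) = f-mor σ tk-proper
          τ⊆ w = Equivalence.to (preimage w)
      in σ⊈fc (Equivalence.from (preimage c)
                 (⊆-trans (⊆-∩ (τ⊆ a σ⊆fa) (τ⊆ b σ⊆fb)) a∩b⊆c))

  morphism-mono : (a c : Word C) → proj₁ a ⊆ proj₁ c → proj₁ (f a) ⊆ proj₁ (f c)
  morphism-mono a c a⊆c =
    ⊆-image-∩-closed a a c ⊆-refl ⊆-refl (⊆-trans (p∩q⊆p _ _) a⊆c)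

proposition38 : ∀ {m n} (C : Code m) (D : Code n) (f : Word C → Word D) →
    IsMorphism C D f →
    (c₁ c₂ : Word C) → (h : T (mem C (proj₁ c₁ ∩ proj₁ c₂))) →
    proj₁ (f (proj₁ c₁ ∩ proj₁ c₂ , h)) ≡ proj₁ (f c₁) ∩ proj₁ (f c₂)
proposition38 C D f f-mor c₁ c₂ h =
  ⊆-antisym
    (⊆-∩ (morphism-mono c₁₂ c₁ (p∩q⊆p _ _))
         (morphism-mono c₁₂ c₂ (p∩q⊆q _ _)))
    (⊆-image-∩-closed c₁ c₂ c₁₂ (p∩q⊆p _ _) (p∩q⊆q _ _) ⊆-refl)
  where
  open Morphism C D f f-mor
  c₁₂ : Word C
  c₁₂ = proj₁ c₁ ∩ proj₁ c₂ , h
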